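{- Let $(F_k)$ be the Fibonacci sequence and $\phi=(1+\sqrt5)/2$. If $g$ is a complex number different from $0$, $-\phi$ and $1/\phi$, then for every positive integer $n$, \[ F_{n}=\left(\frac{ -g}{g^{2}+g-1}\right)^{n}\sum_{r=0}^{2n}\sum_{i=0}^{r}\binom{n}{i}\binom{n}{r-i}(-1)^{r+i}g^{r-2i}F_{r}. \]
   Context: The Fibonacci sequence is defined by $F_0=0$, $F_1=1$, $F_{i+1}=F_i+F_{i-1}$ for $i\ge1$. Binomial coefficients $\binom{n}{b}$ are $0$ when $b<0$ or $b>n$. -}

module Defs where

open import Data.Nat using (ℕ; zero; suc; _∸_; _≤ᵇ_) renaming (_+_ to _+ℕ_; _*_ to _*ℕ_)
open import Data.Nat.Combinatorics using (_C_)
open import Data.Bool using (if_then_else_)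
open import Algebra.Bundles using (CommutativeRing; Semiring)
import Algebra.Definitions.RawSemiring as RS

fib : ℕ → ℕ
fib zero = 0
fib (suc zero) = 1
fib (suc (suc n)) = fib (suc n) +ℕ fib n

module _ {c ℓ} (R : CommutativeRing c ℓ) where
  open CommutativeRing R hiding (zero)
  open RS (Semiring.rawSemiring semiring) using (_×_; _^_)

  ℕ→R : ℕ → Carrier
  ℕ→R k = k × 1#

  pow : Carrier → ℕ → Carrier
  pow x k = x ^ k

  sumTo : ℕ → (ℕ → Carrier) → Carrier
  sumTo zero f = f zero
  sumTo (suc n) f = sumTo n f + f (suc n)

  -- integer power g^(a - b), where ginv is the inverse of g
  zpow : Carrier → Carrier → ℕ → ℕ → Carrier
  zpow g ginv a b = if b ≤ᵇ a then g ^ (a ∸ b) else ginv ^ (b ∸ a)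

  -- Σ_{r=0}^{2n} Σ_{i=0}^{r} C(n,i) C(n,r-i) (-1)^(r+i) g^(r-2i) F_r
  -- (binomial coefficients are 0 outside range, as for Data.Nat.Combinatorics._C_)
  doubleSum : ℕ → Carrier → Carrier → Carrier
  doubleSum n g ginv =
    sumTo (2 *ℕ n) λ r → sumTo r λ i →
      ℕ→R ((n C i) *ℕ (n C (r ∸ i))) * ((- 1#) ^ (r +ℕ i)) * zpow g ginv r (2 *ℕ i) * ℕ→R (fib r)

module Submission where

-- Write E for the shift operator on sequences, (Ef)(m) = f(m+1),
-- and Bₙ,α for the operator (1 + αE)ⁿ, i.e. Bₙ,α f (m) = Σᵢ C(n,i) αⁱ f(m+i).
-- With α = g⁻¹ and β = -g, substituting r = i + k shows that the double sum of
-- the theorem is Bₙ,α (Bₙ,β F) evaluated at 0; the summation range r ≤ 2n can be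
-- cut down to the square i, k ≤ n because the binomial coefficients vanish
-- beyond n.  Now (1 + αE)(1 + βE) = 1 + (α+β)E + αβE², and on any sequence with
-- f(m+2) = f(m+1) + f(m) this acts as (1 + αβ) + (α + β + αβ)E.  Since
-- 1 + αβ = 0, it acts as a·E with a = α + β + αβ, so by induction on n
-- Bₙ,α (Bₙ,β F) = aⁿ Eⁿ F, and at 0 the double sum equals aⁿ Fₙ.  Finally
-- -g/(g² + g - 1) is the inverse of a = g⁻¹ - g - 1, which gives the theorem.

open import Defs
open import Data.Nat using (ℕ; zero; suc; _∸_; _≤_; _<_; _≤ᵇ_; z≤n; s≤s)
  renaming (_+_ to _+ℕ_; _*_ to _*ℕ_)
import Data.Nat.Properties as ℕ
open import Data.Nat.Combinatorics using (_C_; nCk+nC[k+1]≡[n+1]C[k+1]; k>n⇒nCk≡0)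
open import Data.Bool using (true; false)
open import Relation.Nullary.Reflects using (ofʸ; ofⁿ)
open import Relation.Binary.PropositionalEquality as ≡ using (_≡_)
open import Algebra.Bundles using (CommutativeRing; Semiring)
import Algebra.Definitions.RawSemiring as RawSemiring
import Algebra.Properties.Semiring.Mult as SemiringMult
import Algebra.Properties.CommutativeSemiring.Exp as CommutativeExp
import Algebra.Properties.Ring as RingProperties
import Algebra.Solver.Ring.NaturalCoefficients.Default as NaturalSolver
import Relation.Binary.Reasoning.Setoid as SetoidReasoning

module WithRing {c ℓ} (R : CommutativeRing c ℓ) where
  open CommutativeRing R hiding (zero)
  open RawSemiring (Semiring.rawSemiring semiring) using (_^_)
  open SemiringMult semiring using (×-homo-+; ×1-homo-*)
  open CommutativeExp commutativeSemiring using (^-homo-*; ^-distrib-*; ^-congˡ)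
  open RingProperties ring using (-1*x≈-x; -‿distribˡ-*; -‿distribʳ-*; -‿involutive)
  open NaturalSolver commutativeSemiring using (solve; _:=_; _:+_; _:*_; con)
  open SetoidReasoning setoid

  ≡⇒≈ : ∀ {x y} → x ≡ y → x ≈ y
  ≡⇒≈ ≡.refl = refl

  Seq : Set c
  Seq = ℕ → Carrier

  nr : ℕ → Carrier
  nr = ℕ→R R

  sumTo-congᵇ : ∀ N {f h : Seq} → (∀ k → k ≤ N → f k ≈ h k) → sumTo R N f ≈ sumTo R N h
  sumTo-congᵇ zero    f≈h = f≈h 0 z≤n
  sumTo-congᵇ (suc N) f≈h =
    +-cong (sumTo-congᵇ N (λ k k≤N → f≈h k (ℕ.m≤n⇒m≤1+n k≤N))) (f≈h (suc N) ℕ.≤-refl)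

  sumTo-cong : ∀ N {f h : Seq} → (∀ k → f k ≈ h k) → sumTo R N f ≈ sumTo R N h
  sumTo-cong N f≈h = sumTo-congᵇ N (λ k _ → f≈h k)

  sumTo-+ : ∀ N (f h : Seq) → sumTo R N (λ k → f k + h k) ≈ sumTo R N f + sumTo R N h
  sumTo-+ zero    f h = refl
  sumTo-+ (suc N) f h = trans (+-congʳ (sumTo-+ N f h)) (swap _ _ _ _)
    where
    swap : ∀ a b c d → (a + b) + (c + d) ≈ (a + c) + (b + d)
    swap = solve 4 (λ a b c d → (a :+ b) :+ (c :+ d) := (a :+ c) :+ (b :+ d)) refl

  sumTo-*ˡ : ∀ N x (f : Seq) → sumTo R N (λ k → x * f k) ≈ x * sumTo R N f
  sumTo-*ˡ zero    x f = refl
  sumTo-*ˡ (suc N) x f = trans (+-congʳ (sumTo-*ˡ N x f)) (sym (distribˡ x _ _))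

  sumTo-head : ∀ N (f : Seq) → sumTo R (suc N) f ≈ f 0 + sumTo R N (λ k → f (suc k))
  sumTo-head zero    f = refl
  sumTo-head (suc N) f = trans (+-congʳ (sumTo-head N f)) (+-assoc _ _ _)

  sumTo-truncate : ∀ n d (f : Seq) → (∀ k → n < k → f k ≈ 0#) → sumTo R (n +ℕ d) f ≈ sumTo R n f
  sumTo-truncate n zero    f vanish = ≡⇒≈ (≡.cong (λ t → sumTo R t f) (ℕ.+-identityʳ n))
  sumTo-truncate n (suc d) f vanish rewrite ℕ.+-suc n d =
    trans (+-cong (sumTo-truncate n d f vanish) (vanish _ (s≤s (ℕ.m≤m+n n d))))
          (+-identityʳ _)

  sumTo-diagonal : ∀ N (h : ℕ → Seq) →
    sumTo R N (λ r → sumTo R r (h r)) ≈ sumTo R N (λ i → sumTo R (N ∸ i) (λ k → h (i +ℕ k) i))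
  sumTo-diagonal zero    h = refl
  sumTo-diagonal (suc N) h = sym (begin
      sumTo R N (λ i → column (suc N) i) + column (suc N) (suc N)
    ≈⟨ +-cong (sumTo-congᵇ N grow) lastColumn ⟩
      sumTo R N (λ i → column N i + h (suc N) i) + h (suc N) (suc N)
    ≈⟨ +-congʳ (sumTo-+ N _ _) ⟩
      (sumTo R N (column N) + sumTo R N (h (suc N))) + h (suc N) (suc N)
    ≈⟨ +-assoc _ _ _ ⟩
      sumTo R N (column N) + sumTo R (suc N) (h (suc N))
    ≈⟨ +-congʳ (sym (sumTo-diagonal N h)) ⟩
      sumTo R N (λ r → sumTo R r (h r)) + sumTo R (suc N) (h (suc N))
    ∎)
    where
    column : ℕ → ℕ → Carrier
    column M i = sumTo R (M ∸ i) (λ k → h (i +ℕ k) i)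
    grow : ∀ i → i ≤ N → column (suc N) i ≈ column N i + h (suc N) i
    grow i i≤N rewrite ℕ.+-∸-assoc 1 i≤N =
      +-congˡ (≡⇒≈ (≡.cong (λ t → h t i) (≡.trans (ℕ.+-suc i (N ∸ i)) (≡.cong suc (ℕ.m+[n∸m]≡n i≤N)))))
    lastColumn : column (suc N) (suc N) ≈ h (suc N) (suc N)
    lastColumn rewrite ℕ.n∸n≡0 N = ≡⇒≈ (≡.cong (λ t → h t (suc N)) (ℕ.+-identityʳ (suc N)))

  nr-+ : ∀ m n → nr (m +ℕ n) ≈ nr m + nr n
  nr-+ = ×-homo-+ 1#

  nr-C-vanish : ∀ n k → n < k → nr (n C k) ≈ 0#
  nr-C-vanish n k n<k = ≡⇒≈ (≡.cong nr (k>n⇒nCk≡0 n<k))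

  step : Carrier → Seq → Seq
  step β f m = f m + β * f (suc m)

  binom : ℕ → Carrier → Seq → Seq
  binom n α f m = sumTo R n (λ i → nr (n C i) * α ^ i * f (m +ℕ i))

  binom-cong : ∀ n α {f h : Seq} → (∀ m → f m ≈ h m) → ∀ m → binom n α f m ≈ binom n α h m
  binom-cong n α f≈h m = sumTo-cong n (λ i → *-congˡ (f≈h (m +ℕ i)))

  binom-scale : ∀ n α x (f : Seq) m → binom n α (λ k → x * f k) m ≈ x * binom n α f m
  binom-scale n α x f m = trans (sumTo-cong n (λ i → rotate _ x _)) (sumTo-*ˡ n x _)
    where
    rotate : ∀ a x y → a * (x * y) ≈ x * (a * y)
    rotate = solve 3 (λ a x y → a :* (x :* y) := x :* (a :* y)) refl

  binom-zero : ∀ α (f : Seq) m → binom 0 α f m ≈ f m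
  binom-zero α f m =
    trans (*-congʳ (*-identityʳ _)) (trans (*-cong (+-identityʳ 1#) (≡⇒≈ (≡.cong f (ℕ.+-identityʳ m))))
                                             (*-identityˡ _))

  -- Binomial operators commute with 1 + βE (both are linear and commute with E).
  binom-step : ∀ n α β (f : Seq) m → binom n α (step β f) m ≈ step β (binom n α f) m
  binom-step n α β f m = begin
      binom n α (step β f) m
    ≈⟨ sumTo-cong n (λ i → expand _ β _ _) ⟩
      sumTo R n (λ i → nr (n C i) * α ^ i * f (m +ℕ i) + β * (nr (n C i) * α ^ i * f (suc m +ℕ i)))
    ≈⟨ trans (sumTo-+ n _ _) (+-congˡ (sumTo-*ˡ n β _)) ⟩
      step β (binom n α f) m
    ∎
    where
    expand : ∀ a β x y → a * (x + β * y) ≈ a * x + β * (a * y)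
    expand = solve 4 (λ a β x y → a :* (x :+ β :* y) := a :* x :+ β :* (a :* y)) refl

  binom-suc : ∀ n α (f : Seq) m → binom (suc n) α f m ≈ step α (binom n α f) m
  binom-suc n α f m = begin
      binom (suc n) α f m
    ≈⟨ sumTo-head n t ⟩
      t 0 + sumTo R n (λ i → t (suc i))
    ≈⟨ +-congˡ (trans (sumTo-cong n pascal) (sumTo-+ n _ _)) ⟩
      u 0 + (sumTo R n (λ i → u (suc i)) + sumTo R n (λ i → α * v i))
    ≈⟨ trans (sym (+-assoc _ _ _)) (+-cong (sym (sumTo-head n u)) (sumTo-*ˡ n α v)) ⟩
      (binom n α f m + u (suc n)) + α * binom n α f (suc m)
    ≈⟨ +-congʳ (trans (+-congˡ topVanishes) (+-identityʳ _)) ⟩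
      step α (binom n α f) m
    ∎
    where
    t u v : Seq
    t i = nr (suc n C i) * α ^ i * f (m +ℕ i)
    u i = nr (n C i) * α ^ i * f (m +ℕ i)
    v i = nr (n C i) * α ^ i * f (suc m +ℕ i)
    split : ∀ a b α p y → (a + b) * (α * p) * y ≈ b * (α * p) * y + α * (a * p * y)
    split = solve 5 (λ a b α p y → (a :+ b) :* (α :* p) :* y := b :* (α :* p) :* y :+ α :* (a :* p :* y)) refl
    pascal : ∀ i → t (suc i) ≈ u (suc i) + α * v i
    pascal i = begin
        nr (suc n C suc i) * (α * α ^ i) * f (m +ℕ suc i)
      ≈⟨ *-cong (*-congʳ (trans (≡⇒≈ (≡.cong nr (≡.sym (nCk+nC[k+1]≡[n+1]C[k+1] n i)))) (nr-+ (n C i) (n C suc i))))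
                (≡⇒≈ (≡.cong f (ℕ.+-suc m i))) ⟩
        (nr (n C i) + nr (n C suc i)) * (α * α ^ i) * f (suc m +ℕ i)
      ≈⟨ split _ _ _ _ _ ⟩
        nr (n C suc i) * (α * α ^ i) * f (suc m +ℕ i) + α * v i
      ≈⟨ +-congʳ (*-congˡ (≡⇒≈ (≡.cong f (≡.sym (ℕ.+-suc m i))))) ⟩
        u (suc i) + α * v i
      ∎
    topVanishes : u (suc n) ≈ 0#
    topVanishes = trans (*-congʳ (trans (*-congʳ (nr-C-vanish n (suc n) ℕ.≤-refl)) (zeroˡ _))) (zeroˡ _)

  IsFibonacci : Seq → Set ℓ
  IsFibonacci f = ∀ m → f (suc (suc m)) ≈ f (suc m) + f m

  fib-isFibonacci : IsFibonacci (λ k → nr (fib k))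
  fib-isFibonacci m = nr-+ (fib (suc m)) (fib m)

  step-step : ∀ α β {f : Seq} → IsFibonacci f → ∀ m →
    step α (step β f) m ≈ (1# + α * β) * f m + (α + β + α * β) * f (suc m)
  step-step α β {f} isFib m = begin
      f m + β * f (suc m) + α * (f (suc m) + β * f (suc (suc m)))
    ≈⟨ +-congˡ (*-congˡ (+-congˡ (*-congˡ (isFib m)))) ⟩
      f m + β * f (suc m) + α * (f (suc m) + β * (f (suc m) + f m))
    ≈⟨ collect α β (f m) (f (suc m)) ⟩
      (1# + α * β) * f m + (α + β + α * β) * f (suc m)
    ∎
    where
    collect : ∀ α β x y → x + β * y + α * (y + β * (y + x)) ≈ (1# + α * β) * x + (α + β + α * β) * y
    collect = solve 4 (λ α β x y → x :+ β :* y :+ α :* (y :+ β :* (y :+ x))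
                          := (con 1 :+ α :* β) :* x :+ (α :+ β :+ α :* β) :* y) refl

  binom-binom-fibonacci : ∀ α β → 1# + α * β ≈ 0# → ∀ n {f : Seq} → IsFibonacci f → ∀ m →
    binom n α (binom n β f) m ≈ (α + β + α * β) ^ n * f (n +ℕ m)
  binom-binom-fibonacci α β αβ zero {f} isFib m =
    trans (binom-zero α (binom 0 β f) m) (trans (binom-zero β f m) (sym (*-identityˡ _)))
  binom-binom-fibonacci α β αβ (suc n) {f} isFib m = begin
      binom (suc n) α (binom (suc n) β f) m
    ≈⟨ binom-cong (suc n) α {binom (suc n) β f} peel m ⟩
      binom (suc n) α (binom n β (step β f)) m
    ≈⟨ binom-suc n α (binom n β (step β f)) m ⟩
      step α (binom n α (binom n β (step β f))) m
    ≈⟨ sym (binom-step n α α (binom n β (step β f)) m) ⟩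
      binom n α (step α (binom n β (step β f))) m
    ≈⟨ binom-cong n α {step α (binom n β (step β f))} (λ k → sym (binom-step n β α (step β f) k)) m ⟩
      binom n α (binom n β (step α (step β f))) m
    ≈⟨ binom-cong n α (binom-cong n β {step α (step β f)} (λ k → trans (step-step α β isFib k) cancel)) m ⟩
      binom n α (binom n β (λ k → a * f (suc k))) m
    ≈⟨ trans (binom-cong n α (binom-scale n β a f′) m) (binom-scale n α a (binom n β f′) m) ⟩
      a * binom n α (binom n β f′) m
    ≈⟨ *-congˡ (binom-binom-fibonacci α β αβ n (λ k → isFib (suc k)) m) ⟩
      a * (a ^ n * f (suc n +ℕ m))
    ≈⟨ sym (*-assoc _ _ _) ⟩
      a ^ suc n * f (suc n +ℕ m)
    ∎
    where
    a : Carrier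
    a = α + β + α * β
    f′ : Seq
    f′ k = f (suc k)
    peel : ∀ k → binom (suc n) β f k ≈ binom n β (step β f) k
    peel k = trans (binom-suc n β f k) (sym (binom-step n β β f k))
    cancel : ∀ {x y} → (1# + α * β) * x + a * y ≈ a * y
    cancel {x} = trans (+-congʳ (trans (*-congʳ αβ) (zeroˡ x))) (+-identityˡ _)

  pow-inverse : ∀ x y → x * y ≈ 1# → ∀ n → x ^ n * y ^ n ≈ 1#
  pow-inverse x y xy n = trans (sym (^-distrib-* x y n)) (trans (^-congˡ n xy) (one-pow n))
    where
    one-pow : ∀ n → 1# ^ n ≈ 1#
    one-pow zero    = refl
    one-pow (suc n) = trans (*-identityˡ _) (one-pow n)

  zpow≈ : ∀ g ginv → g * ginv ≈ 1# → ∀ a b → zpow R g ginv a b ≈ g ^ a * ginv ^ b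
  zpow≈ g ginv gi a b with b ≤ᵇ a | ℕ.≤ᵇ-reflects-≤ b a
  ... | true  | ofʸ b≤a = sym (begin
      g ^ a * ginv ^ b
    ≈⟨ *-congʳ (trans (≡⇒≈ (≡.cong (g ^_) (≡.sym (ℕ.m+[n∸m]≡n b≤a)))) (^-homo-* g b (a ∸ b))) ⟩
      (g ^ b * g ^ (a ∸ b)) * ginv ^ b
    ≈⟨ trans (*-congʳ (*-comm _ _)) (*-assoc _ _ _) ⟩
      g ^ (a ∸ b) * (g ^ b * ginv ^ b)
    ≈⟨ trans (*-congˡ (pow-inverse g ginv gi b)) (*-identityʳ _) ⟩
      g ^ (a ∸ b)
    ∎)
  ... | false | ofⁿ b≰a = sym (begin
      g ^ a * ginv ^ b
    ≈⟨ *-congˡ (trans (≡⇒≈ (≡.cong (ginv ^_) (≡.sym (ℕ.m+[n∸m]≡n a≤b)))) (^-homo-* ginv a (b ∸ a))) ⟩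
      g ^ a * (ginv ^ a * ginv ^ (b ∸ a))
    ≈⟨ trans (sym (*-assoc _ _ _)) (trans (*-congʳ (pow-inverse g ginv gi a)) (*-identityˡ _)) ⟩
      ginv ^ (b ∸ a)
    ∎)
    where
    a≤b : a ≤ b
    a≤b = ℕ.<⇒≤ (ℕ.≰⇒> b≰a)

  pow-cancel : ∀ x y → x * y ≈ 1# → ∀ c a b → x ^ (c +ℕ a) * y ^ (c +ℕ b) ≈ x ^ a * y ^ b
  pow-cancel x y xy c a b = begin
      x ^ (c +ℕ a) * y ^ (c +ℕ b)
    ≈⟨ *-cong (^-homo-* x c a) (^-homo-* y c b) ⟩
      (x ^ c * x ^ a) * (y ^ c * y ^ b)
    ≈⟨ interchange _ _ _ _ ⟩
      (x ^ c * y ^ c) * (x ^ a * y ^ b)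
    ≈⟨ trans (*-congʳ (pow-inverse x y xy c)) (*-identityˡ _) ⟩
      x ^ a * y ^ b
    ∎
    where
    interchange : ∀ p q r s → (p * q) * (r * s) ≈ (p * r) * (q * s)
    interchange = solve 4 (λ p q r s → (p :* q) :* (r :* s) := (p :* r) :* (q :* s)) refl

  sign-pow : ∀ i k → (- 1#) ^ (i +ℕ k +ℕ i) ≈ (- 1#) ^ k
  sign-pow i k = begin
      (- 1#) ^ (i +ℕ k +ℕ i)
    ≡⟨ ≡.cong ((- 1#) ^_) (≡.trans (≡.cong (_+ℕ i) (ℕ.+-comm i k)) (ℕ.+-assoc k i i)) ⟩
      (- 1#) ^ (k +ℕ (i +ℕ i))
    ≈⟨ trans (^-homo-* _ k (i +ℕ i)) (*-congˡ (^-homo-* _ i i)) ⟩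
      (- 1#) ^ k * ((- 1#) ^ i * (- 1#) ^ i)
    ≈⟨ trans (*-congˡ (pow-inverse _ _ minusOneSquared i)) (*-identityʳ _) ⟩
      (- 1#) ^ k
    ∎
    where
    minusOneSquared : - 1# * - 1# ≈ 1#
    minusOneSquared = trans (-1*x≈-x (- 1#)) (-‿involutive 1#)

  module DoubleSum (g ginv : Carrier) (gi : g * ginv ≈ 1#) (n : ℕ) where

    summand : ℕ → ℕ → Carrier
    summand r i = nr ((n C i) *ℕ (n C (r ∸ i))) * (- 1#) ^ (r +ℕ i) * zpow R g ginv r (2 *ℕ i) * nr (fib r)

    outer : ℕ → Carrier
    outer i = nr (n C i) * ginv ^ i

    inner : ℕ → ℕ → Carrier
    inner i k = nr (n C k) * (- g) ^ k * nr (fib (i +ℕ k))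

    summand≈ : ∀ i k → summand (i +ℕ k) i ≈ outer i * inner i k
    summand≈ i k = begin
        summand (i +ℕ k) i
      ≈⟨ *-congʳ (*-cong (*-cong binomials (sign-pow i k)) power) ⟩
        (nr (n C i) * nr (n C k)) * (- 1#) ^ k * (g ^ k * ginv ^ i) * nr (fib (i +ℕ k))
      ≈⟨ rearrange _ _ _ _ _ _ ⟩
        outer i * (nr (n C k) * ((- 1#) ^ k * g ^ k) * nr (fib (i +ℕ k)))
      ≈⟨ *-congˡ (*-congʳ (*-congˡ (sym negate))) ⟩
        outer i * inner i k
      ∎
      where
      binomials : nr ((n C i) *ℕ (n C (i +ℕ k ∸ i))) ≈ nr (n C i) * nr (n C k)
      binomials = trans (≡⇒≈ (≡.cong (λ t → nr ((n C i) *ℕ (n C t))) (ℕ.m+n∸m≡n i k))) (×1-homo-* (n C i) (n C k))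
      power : zpow R g ginv (i +ℕ k) (2 *ℕ i) ≈ g ^ k * ginv ^ i
      power = trans (zpow≈ g ginv gi (i +ℕ k) (2 *ℕ i))
                    (trans (pow-cancel g ginv gi i k (i +ℕ 0)) (*-congˡ (≡⇒≈ (≡.cong (ginv ^_) (ℕ.+-identityʳ i)))))
      negate : (- g) ^ k ≈ (- 1#) ^ k * g ^ k
      negate = trans (^-congˡ k (sym (-1*x≈-x g))) (^-distrib-* (- 1#) g k)
      rearrange : ∀ A B S P Q Y → (A * B) * S * (P * Q) * Y ≈ (A * Q) * (B * (S * P) * Y)
      rearrange = solve 6 (λ A B S P Q Y → (A :* B) :* S :* (P :* Q) :* Y := (A :* Q) :* (B :* (S :* P) :* Y)) refl

    outer-vanish : ∀ i → n < i → outer i ≈ 0#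
    outer-vanish i n<i = trans (*-congʳ (nr-C-vanish n i n<i)) (zeroˡ _)

    inner-vanish : ∀ i k → n < k → inner i k ≈ 0#
    inner-vanish i k n<k = trans (*-congʳ (trans (*-congʳ (nr-C-vanish n k n<k)) (zeroˡ _))) (zeroˡ _)

    row : ∀ i → i ≤ n → sumTo R (2 *ℕ n ∸ i) (inner i) ≈ sumTo R n (inner i)
    row i i≤n rewrite ℕ.+-∸-assoc n (ℕ.m≤n⇒m≤n+o 0 i≤n) =
      sumTo-truncate n (n +ℕ 0 ∸ i) (inner i) (inner-vanish i)

    doubleSum≈binom : doubleSum R n g ginv ≈ binom n ginv (binom n (- g) (λ k → nr (fib k))) 0
    doubleSum≈binom = begin
        doubleSum R n g ginv
      ≈⟨ sumTo-diagonal (2 *ℕ n) summand ⟩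
        sumTo R (2 *ℕ n) (λ i → sumTo R (2 *ℕ n ∸ i) (λ k → summand (i +ℕ k) i))
      ≈⟨ sumTo-cong (2 *ℕ n) (λ i → trans (sumTo-cong (2 *ℕ n ∸ i) (summand≈ i))
                                            (sumTo-*ˡ (2 *ℕ n ∸ i) (outer i) (inner i))) ⟩
        sumTo R (n +ℕ (n +ℕ 0)) (λ i → outer i * sumTo R (2 *ℕ n ∸ i) (inner i))
      ≈⟨ sumTo-truncate n (n +ℕ 0) _ (λ i n<i → trans (*-congʳ (outer-vanish i n<i)) (zeroˡ _)) ⟩
        sumTo R n (λ i → outer i * sumTo R (2 *ℕ n ∸ i) (inner i))
      ≈⟨ sumTo-congᵇ n (λ i i≤n → *-congˡ (row i i≤n)) ⟩
        binom n ginv (binom n (- g) (λ k → nr (fib k))) 0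
      ∎

  module Constants (g ginv dinv : Carrier) (gi : g * ginv ≈ 1#) (di : (g * g + g - 1#) * dinv ≈ 1#) where

    ginv*-g : ginv * (- g) ≈ - 1#
    ginv*-g = trans (sym (-‿distribʳ-* ginv g)) (-‿cong (trans (*-comm ginv g) gi))

    αβ-vanish : 1# + ginv * (- g) ≈ 0#
    αβ-vanish = trans (+-congˡ ginv*-g) (-‿inverseʳ 1#)

    inverse : (- g) * dinv * (ginv + - g + ginv * - g) ≈ 1#
    inverse = begin
        (- g) * dinv * (ginv + - g + ginv * - g)
      ≈⟨ expand (- g) dinv ginv ⟩
        dinv * (ginv * - g) + dinv * (- g * - g) + dinv * (- g * (ginv * - g))
      ≈⟨ +-cong (+-cong (*-congˡ ginv*-g) (*-congˡ squared)) (*-congˡ (trans (*-congˡ ginv*-g) minusOne)) ⟩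
        dinv * - 1# + dinv * (g * g) + dinv * g
      ≈⟨ collect dinv (- 1#) g ⟩
        (g * g + g - 1#) * dinv
      ≈⟨ di ⟩
        1#
      ∎
      where
      squared : - g * - g ≈ g * g
      squared = trans (sym (-‿distribˡ-* g (- g))) (trans (-‿cong (sym (-‿distribʳ-* g g))) (-‿involutive _))
      minusOne : - g * - 1# ≈ g
      minusOne = trans (*-comm _ _) (trans (-1*x≈-x (- g)) (-‿involutive g))
      expand : ∀ x d y → x * d * (y + x + y * x) ≈ d * (y * x) + d * (x * x) + d * (x * (y * x))
      expand = solve 3 (λ x d y → x :* d :* (y :+ x :+ y :* x)
                          := d :* (y :* x) :+ d :* (x :* x) :+ d :* (x :* (y :* x))) refl
      collect : ∀ d m g → d * m + d * (g * g) + d * g ≈ (g * g + g + m) * d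
      collect = solve 3 (λ d m g → d :* m :+ d :* (g :* g) :+ d :* g := (g :* g :+ g :+ m) :* d) refl

corollary5 : ∀ {c ℓ} (R : CommutativeRing c ℓ) →
    let open CommutativeRing R in
    (g ginv dinv : Carrier) →
    g * ginv ≈ 1# →
    (g * g + g - 1#) * dinv ≈ 1# →
    (n : ℕ) → 1 ≤ n →
    ℕ→R R (fib n) ≈ pow R ((- g) * dinv) n * doubleSum R n g ginv
corollary5 R g ginv dinv gi di n _ = sym (begin
    x ^ n * doubleSum R n g ginv
  ≈⟨ *-congˡ (DoubleSum.doubleSum≈binom g ginv gi n) ⟩
    x ^ n * binom n ginv (binom n (- g) F) 0
  ≈⟨ *-congˡ (binom-binom-fibonacci ginv (- g) αβ-vanish n fib-isFibonacci 0) ⟩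
    x ^ n * (a ^ n * F (n +ℕ 0))
  ≈⟨ trans (sym (*-assoc _ _ _)) (*-congʳ (pow-inverse x a inverse n)) ⟩
    1# * F (n +ℕ 0)
  ≈⟨ trans (*-identityˡ _) (≡⇒≈ (≡.cong F (ℕ.+-identityʳ n))) ⟩
    F n
  ∎)
  where
  open CommutativeRing R
  open WithRing R
  open Constants g ginv dinv gi di
  open RawSemiring (Semiring.rawSemiring semiring) using (_^_)
  open SetoidReasoning setoid
  F : ℕ → Carrier
  F k = ℕ→R R (fib k)
  x a : Carrier
  x = (- g) * dinv
  a = ginv + - g + ginv * - g
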